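{- The set of all bicoloured noncrossing configurations (BNCs), together with the composition maps $\circ_i$ described below and the unique BNC of size $1$ as unit, forms a (non-symmetric) operad $\mathrm{CNCB}$, where the arity of a BNC is its size.
   Context: A BNC of size $n\ge2$ is a regular polygon with $n+1$ vertices labelled $1,\dots,n+1$ clockwise, together with a colouring of each arc $(i,j)$, $1\le i<j\le n+1$, as blue, red or uncoloured, such that no two coloured (blue or red) arcs cross, and every red arc is a diagonal. Two arcs $(i,j),(k,l)$ cross if $i<k<j<l$ or $k<i<l<j$. The arcs $(i,i+1)$, $i\in[n]$, are the edges, $(i,i+1)$ being the $i$-th edge. The arc $(1,n+1)$ is the base. All other arcs are diagonals. In addition there is a unique BNC of size $1$: a single blue arc, which serves both as its first edge and its base. Composition: let $\mathfrak{C}$ have size $n$, $\mathfrak{D}$ have size $m$, and $i\in[n]$. Then $\mathfrak{E}=\mathfrak{C}\circ_i\mathfrak{D}$ is the BNC of size $n+m-1$ obtained by gluing the base of $\mathfrak{D}$ onto the $i$-th edge of $\mathfrak{C}$. Precisely, vertex $j$ of $\mathfrak{C}$ becomes vertex $j$ of $\mathfrak{E}$ if $j\le i$ and vertex $j+m-1$ if $j>i$, and vertex $\ell$ of $\mathfrak{D}$ becomes vertex $i+\ell-1$ of $\mathfrak{E}$. Every arc of $\mathfrak{C}$ other than its $i$-th edge, and every arc of $\mathfrak{D}$ other than its base, keeps its colour at its image. The arc $(i,i+m)$ of $\mathfrak{E}$ is red if the $i$-th edge of $\mathfrak{C}$ and the base of $\mathfrak{D}$ are both uncoloured, blue if both are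 blue, and uncoloured otherwise. All remaining arcs of $\mathfrak{E}$ are uncoloured. (The resulting figure is redrawn as a regular polygon.) -}

module Defs where

open import Data.Nat using (ℕ; zero; suc; _+_; _∸_; _≤_; _<_; _≤ᵇ_; _≡ᵇ_)
open import Data.Bool using (Bool; true; false; if_then_else_; _∧_; _∨_)
open import Data.Product using (_×_)
open import Data.Empty using (⊥)
open import Data.Unit using (⊤)
open import Relation.Nullary using (¬_)
open import Relation.Binary.PropositionalEquality using (_≡_)

data Colour : Set where
  blue red uncoloured : Colour

-- Vertices are numbered 1,2,...,n+1 (as in the paper);
-- the colour of arc (i,j), 1 ≤ i < j ≤ n+1, is  c i j.  Values of c outside
-- the valid arcs are irrelevant (equality below only looks at valid arcs).
Col : Set
Col = ℕ → ℕ → Colour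

Coloured : Colour → Set
Coloured blue       = ⊤
Coloured red        = ⊤
Coloured uncoloured = ⊥

ValidArc : ℕ → ℕ → ℕ → Set
ValidArc n i j = (1 ≤ i) × (i < j) × (j ≤ suc n)

-- (i,j) is a diagonal: neither an edge (j = i+1) nor the base (1, n+1)
IsDiagonal : ℕ → ℕ → ℕ → Set
IsDiagonal n i j = (¬ (j ≡ suc i)) × (¬ ((i ≡ 1) × (j ≡ suc n)))

-- A BNC of size n (n ≥ 1).  For n ≥ 2: no two coloured arcs cross and every
-- red arc is a diagonal.  For n = 1 the unique BNC is the single blue arc (1,2).
record IsBNC (n : ℕ) (c : Col) : Set where
  field
    size-pos   : 1 ≤ n
    size-one   : n ≡ 1 → c 1 2 ≡ blue
    noncrossing : ∀ i j k l → 1 ≤ i → i < k → k < j → j < l → l ≤ suc n →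
                  Coloured (c i j) → Coloured (c k l) → ⊥
    red-diag   : ∀ i j → ValidArc n i j → c i j ≡ red → IsDiagonal n i j

_≈[_]_ : Col → ℕ → Col → Set
c ≈[ n ] c' = ∀ i j → ValidArc n i j → c i j ≡ c' i j

-- colour of the glued arc (i,i+m), from the i-th edge of C and the base of D
glue : Colour → Colour → Colour
glue uncoloured uncoloured = red
glue blue       blue       = blue
glue _          _          = uncoloured

-- preimage in C of a vertex of E lying outside the interior of D's image
preC : ℕ → ℕ → ℕ → ℕ
preC i m a = if a ≤ᵇ i then a else a ∸ (m ∸ 1)

-- is vertex a of E the image of a vertex of C ?
isCvertex : ℕ → ℕ → ℕ → Bool
isCvertex i m a = (a ≤ᵇ i) ∨ ((i + m) ≤ᵇ a)

-- Composition  E = C ∘_i D  (C of size n, D of size m), E of size n + m - 1.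
-- Vertex j of C ↦ j (j ≤ i), j + m - 1 (j > i); vertex ℓ of D ↦ i + ℓ - 1.
compose : (n m : ℕ) → Col → ℕ → Col → Col
compose n m c i d a b =
  if (i ≤ᵇ a) ∧ (b ≤ᵇ i + m)
  then (if (a ≡ᵇ i) ∧ (b ≡ᵇ i + m)
        then glue (c i (suc i)) (d 1 (suc m))
        else d (suc (a ∸ i)) (suc (b ∸ i)))
  else (if isCvertex i m a ∧ isCvertex i m b
        then c (preC i m a) (preC i m b)
        else uncoloured)

unitBNC : Col
unitBNC _ _ = blue

record CNCB-IsOperad : Set where
  field
    compose-closed : ∀ n m c d i → IsBNC n c → IsBNC m d → 1 ≤ i → i ≤ n →
                     IsBNC (n + m ∸ 1) (compose n m c i d)
    unit-closed    : IsBNC 1 unitBNC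
    compose-cong   : ∀ n m c c' d d' i → IsBNC n c → IsBNC m d → 1 ≤ i → i ≤ n →
                     c ≈[ n ] c' → d ≈[ m ] d' →
                     compose n m c i d ≈[ n + m ∸ 1 ] compose n m c' i d'
    assoc-seq : ∀ n m k x y z i j → IsBNC n x → IsBNC m y → IsBNC k z →
                1 ≤ i → i ≤ n → 1 ≤ j → j ≤ m →
                compose (n + m ∸ 1) k (compose n m x i y) (i + j ∸ 1) z
                  ≈[ n + m + k ∸ 2 ]
                compose n (m + k ∸ 1) x i (compose m k y j z)
    assoc-par : ∀ n m k x y z i j → IsBNC n x → IsBNC m y → IsBNC k z →
                1 ≤ i → i < j → j ≤ n →
                compose (n + m ∸ 1) k (compose n m x i y) (j + m ∸ 1) z
                  ≈[ n + m + k ∸ 2 ]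
                compose (n + k ∸ 1) m (compose n k x j z) i y
    unit-left  : ∀ n x → IsBNC n x → compose 1 n unitBNC 1 x ≈[ n ] x
    unit-right : ∀ n x i → IsBNC n x → 1 ≤ i → i ≤ n →
                 compose n 1 x i unitBNC ≈[ n ] x

-- Every arc of C ∘ᵢ D arises in exactly one way: it is the glued arc (i, i + m), the image
-- of an arc of D other than its base, the image of an arc of C other than its i-th edge, or
-- it joins a vertex strictly inside the image of D to one outside it, and is uncoloured.
-- Reading colours off this classification, a crossing or a badly placed red arc of C ∘ᵢ D
-- would come from one in C or D, a factor of size 1 only relabels vertices, and equal
-- factors give equal composites.  For associativity, classify an arc through both levels
-- of either side: that side is uncoloured there, or the arc comes from x, y or z or from
-- a glued arc, and then the other side has the same colour.  The only coincidence needing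
-- care is the doubly glued arc when y has size 1: its single arc is blue and edges and
-- bases are never red, so glue (glue a blue) c = glue a c = glue a (glue blue c).

module Submission where

open import Defs
open import Data.Nat
  using (ℕ; zero; suc; _+_; _∸_; _≤_; _<_; _≤ᵇ_; _≡ᵇ_; z≤n; s≤s; z<s; _≤?_; _<?_; _≟_)
open import Data.Nat.Properties
open import Data.Bool using (true; false; if_then_else_; _∧_; _∨_)
open import Data.Bool.Properties using (if-cong; T-≡; ∧-zeroʳ; ∨-zeroʳ)
open import Data.Product using (_×_; _,_; proj₁; proj₂)
open import Data.Sum using (_⊎_; inj₁; inj₂; [_,_]; map)
open import Data.Empty using (⊥; ⊥-elim)
open import Function.Bundles using (Equivalence)
open import Relation.Nullary using (¬_; yes; no)
open import Relation.Nullary.Decidable using (_×-dec_)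
open import Relation.Binary.PropositionalEquality hiding ([_])
open import Algebra.Properties.CommutativeSemigroup +-commutativeSemigroup using (xy∙z≈xz∙y)

≤ᵇ-true : ∀ {a b} → a ≤ b → (a ≤ᵇ b) ≡ true
≤ᵇ-true a≤b = Equivalence.to T-≡ (≤⇒≤ᵇ a≤b)

≤ᵇ-false : ∀ {a b} → b < a → (a ≤ᵇ b) ≡ false
≤ᵇ-false {a} {b} b<a with a ≤ᵇ b in eq
... | false = refl
... | true  = ⊥-elim (<⇒≱ b<a (≤ᵇ⇒≤ a b (Equivalence.from T-≡ eq)))

≡ᵇ-true : ∀ {a b} → a ≡ b → (a ≡ᵇ b) ≡ true
≡ᵇ-true {a} {b} a≡b = Equivalence.to T-≡ (≡⇒≡ᵇ a b a≡b)

≡ᵇ-false : ∀ {a b} → ¬ a ≡ b → (a ≡ᵇ b) ≡ false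
≡ᵇ-false {a} {b} a≢b with a ≡ᵇ b in eq
... | false = refl
... | true  = ⊥-elim (a≢b (≡ᵇ⇒≡ a b (Equivalence.from T-≡ eq)))

∧-false : ∀ {x y} → x ≡ false ⊎ y ≡ false → (x ∧ y) ≡ false
∧-false         (inj₁ refl) = refl
∧-false {x = x} (inj₂ refl) = ∧-zeroʳ x

≤ᵇ-∧-false : ∀ {a b c d} → ¬ (a ≤ b × c ≤ d) → ((a ≤ᵇ b) ∧ (c ≤ᵇ d)) ≡ false
≤ᵇ-∧-false {a} {b} {c} {d} h with a ≤? b | c ≤? d
... | no a≰b  | _       = ∧-false (inj₁ (≤ᵇ-false (≰⇒> a≰b)))
... | yes _   | no c≰d  = ∧-false (inj₂ (≤ᵇ-false (≰⇒> c≰d)))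
... | yes a≤b | yes c≤d = ⊥-elim (h (a≤b , c≤d))

≡ᵇ-∧-false : ∀ {a b c d} → ¬ (a ≡ b × c ≡ d) → ((a ≡ᵇ b) ∧ (c ≡ᵇ d)) ≡ false
≡ᵇ-∧-false {a} {b} {c} {d} h with a ≟ b | c ≟ d
... | no a≢b  | _       = ∧-false (inj₁ (≡ᵇ-false a≢b))
... | yes _   | no c≢d  = ∧-false (inj₂ (≡ᵇ-false c≢d))
... | yes a≡b | yes c≡d = ⊥-elim (h (a≡b , c≡d))

-- Vertex v of C as a vertex of C ∘ᵢ D, for D of size m; preC is its left inverse.
embC : ℕ → ℕ → ℕ → ℕ
embC i m v = if v ≤ᵇ i then v else v + (m ∸ 1)

CVertex : ℕ → ℕ → ℕ → Set
CVertex i M v = v ≤ i ⊎ i + suc M ≤ v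

Interior : ℕ → ℕ → ℕ → Set
Interior i M v = i < v × v < i + suc M

module _ {i M : ℕ} where

  embC-≤ : ∀ {v} → v ≤ i → embC i (suc M) v ≡ v
  embC-≤ v≤i = if-cong (≤ᵇ-true v≤i)

  embC-> : ∀ {v} → i < v → embC i (suc M) v ≡ v + M
  embC-> i<v = if-cong (≤ᵇ-false i<v)

  preC-≤ : ∀ {v} → v ≤ i → preC i (suc M) v ≡ v
  preC-≤ v≤i = if-cong (≤ᵇ-true v≤i)

  preC-> : ∀ {v} → i < v → preC i (suc M) v ≡ v ∸ M
  preC-> i<v = if-cong (≤ᵇ-false i<v)

  embC-cases : ∀ v → (v ≤ i × embC i (suc M) v ≡ v) ⊎ (i < v × embC i (suc M) v ≡ v + M)
  embC-cases v with v ≤? i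
  ... | yes v≤i = inj₁ (v≤i , embC-≤ v≤i)
  ... | no  v≰i = inj₂ (≰⇒> v≰i , embC-> (≰⇒> v≰i))

  after-D⇒after-i : ∀ {v} → i + suc M ≤ v → i < v
  after-D⇒after-i i+1+M≤v = <-≤-trans (m<m+n i z<s) i+1+M≤v

  embC-CVertex : ∀ s → CVertex i M (embC i (suc M) s)
  embC-CVertex s with embC-cases s
  ... | inj₁ (s≤i , e) rewrite e = inj₁ s≤i
  ... | inj₂ (i<s , e) rewrite e | +-suc i M = inj₂ (+-monoˡ-≤ M i<s)

  cvertex? : ∀ v → CVertex i M v ⊎ Interior i M v
  cvertex? v with v ≤? i | i + suc M ≤? v
  ... | yes v≤i | _       = inj₁ (inj₁ v≤i)
  ... | no  _   | yes i+m≤v = inj₁ (inj₂ i+m≤v)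
  ... | no  v≰i | no  i+m≰v = inj₂ (≰⇒> v≰i , ≰⇒> i+m≰v)

  Interior-¬CVertex : ∀ {v} → Interior i M v → ¬ CVertex i M v
  Interior-¬CVertex (i<v , _)   (inj₁ v≤i)   = <⇒≱ i<v v≤i
  Interior-¬CVertex (_ , v<i+m) (inj₂ i+m≤v) = <⇒≱ v<i+m i+m≤v

  preC-embC : ∀ s → preC i (suc M) (embC i (suc M) s) ≡ s
  preC-embC s with embC-cases s
  ... | inj₁ (s≤i , e) rewrite e = preC-≤ s≤i
  ... | inj₂ (i<s , e) rewrite e = trans (preC-> (<-≤-trans i<s (m≤m+n s M))) (m+n∸n≡m s M)

  embC-preC : ∀ {v} → CVertex i M v → embC i (suc M) (preC i (suc M) v) ≡ v
  embC-preC (inj₁ v≤i) rewrite preC-≤ v≤i = embC-≤ v≤i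
  embC-preC {v} (inj₂ i+1+M≤v) rewrite preC-> (after-D⇒after-i i+1+M≤v) =
    trans (embC-> i<v∸M) (m∸n+n≡m M≤v)
    where
    M≤v : M ≤ v
    M≤v = ≤-trans (m≤n+m M (suc i)) (subst (_≤ v) (+-suc i M) i+1+M≤v)
    i<v∸M : i < v ∸ M
    i<v∸M = subst (_≤ v ∸ M) (m+n∸n≡m (suc i) M) (∸-monoˡ-≤ M (subst (_≤ v) (+-suc i M) i+1+M≤v))

  embC-strictMono : ∀ {s t} → s < t → embC i (suc M) s < embC i (suc M) t
  embC-strictMono {s} {t} s<t with embC-cases s | embC-cases t
  ... | inj₁ (_ , es) | inj₁ (_ , et) rewrite es | et = s<t
  ... | inj₁ (_ , es) | inj₂ (_ , et) rewrite es | et = <-≤-trans s<t (m≤m+n t M)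
  ... | inj₂ (i<s , _) | inj₁ (t≤i , _) = ⊥-elim (<⇒≱ (<-trans i<s s<t) t≤i)
  ... | inj₂ (_ , es) | inj₂ (_ , et) rewrite es | et = +-monoˡ-< M s<t

  embC-mono : ∀ {s t} → s ≤ t → embC i (suc M) s ≤ embC i (suc M) t
  embC-mono s≤t with m≤n⇒m<n∨m≡n s≤t
  ... | inj₁ s<t  = <⇒≤ (embC-strictMono s<t)
  ... | inj₂ refl = ≤-refl

  embC-cancel-< : ∀ {s t} → embC i (suc M) s < embC i (suc M) t → s < t
  embC-cancel-< {s} {t} h with s <? t
  ... | yes s<t = s<t
  ... | no  s≮t = ⊥-elim (<⇒≱ h (embC-mono (≮⇒≥ s≮t)))

  embC-positive : ∀ {s} → 1 ≤ embC i (suc M) s → 1 ≤ s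
  embC-positive {zero}  ()
  embC-positive {suc s} _ = s≤s z≤n

  embC-≥ : ∀ s → s ≤ embC i (suc M) s
  embC-≥ s with embC-cases s
  ... | inj₁ (_ , e) rewrite e = ≤-refl
  ... | inj₂ (_ , e) rewrite e = m≤m+n s M

  embC-bounded : ∀ {n t} → i ≤ n → embC i (suc M) t ≤ suc (n + M) → t ≤ suc n
  embC-bounded {n} {t} i≤n h with embC-cases t
  ... | inj₁ (t≤i , _) = ≤-trans t≤i (≤-trans i≤n (n≤1+n n))
  ... | inj₂ (_ , e) rewrite e = +-cancelʳ-≤ M t (suc n) h

  embC-edge : ∀ {s t v} → s < t → embC i (suc M) s ≡ v → embC i (suc M) t ≡ suc v → t ≡ suc s
  embC-edge {s} {t} s<t refl h with embC-cases s | embC-cases t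
  ... | inj₁ (_ , es) | inj₁ (_ , et) rewrite es | et = h
  ... | inj₁ (_ , es) | inj₂ (_ , et) rewrite es | et = ≤-antisym (subst (t ≤_) h (m≤m+n t M)) s<t
  ... | inj₂ (i<s , _) | inj₁ (t≤i , _) = ⊥-elim (<⇒≱ (<-trans i<s s<t) t≤i)
  ... | inj₂ (_ , es) | inj₂ (_ , et) rewrite es | et = +-cancelʳ-≡ M t (suc s) h

  embC-one : ∀ {s} → 1 ≤ i → embC i (suc M) s ≡ 1 → s ≡ 1
  embC-one {s} 1≤i h with embC-cases s
  ... | inj₁ (_ , e) = trans (sym e) h
  ... | inj₂ (i<s , e) = ⊥-elim (<⇒≱ (≤-<-trans 1≤i i<s) (subst (s ≤_) (trans (sym e) h) (m≤m+n s M)))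

  embC-top : ∀ {n t} → i ≤ n → embC i (suc M) t ≡ suc (n + M) → t ≡ suc n
  embC-top {n} {t} i≤n h with embC-cases t
  ... | inj₁ (t≤i , e) =
    ⊥-elim (<⇒≱ (s≤s (≤-trans i≤n (m≤m+n n M))) (subst (_≤ i) (trans (sym e) h) t≤i))
  ... | inj₂ (_ , e) = +-cancelʳ-≡ M t (suc n) (trans (sym e) h)

  embC≡i+⇒≡i : ∀ {s J} → J ≤ M → embC i (suc M) s ≡ i + J → s ≡ i
  embC≡i+⇒≡i {s} {J} J≤M h with embC-cases s
  ... | inj₁ (s≤i , e) = ≤-antisym s≤i (subst (i ≤_) (trans (sym h) e) (m≤m+n i J))
  ... | inj₂ (i<s , e) =
    ⊥-elim (<⇒≱ (≤-<-trans (+-monoʳ-≤ i J≤M) (+-monoˡ-< M i<s)) (≤-reflexive (trans (sym e) h)))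

  isCvertex-true : ∀ {v} → CVertex i M v → isCvertex i (suc M) v ≡ true
  isCvertex-true {v} (inj₁ v≤i) = cong (_∨ (i + suc M ≤ᵇ v)) (≤ᵇ-true v≤i)
  isCvertex-true {v} (inj₂ i+m≤v) = trans (cong ((v ≤ᵇ i) ∨_) (≤ᵇ-true i+m≤v)) (∨-zeroʳ (v ≤ᵇ i))

  isCvertex-false : ∀ {v} → Interior i M v → isCvertex i (suc M) v ≡ false
  isCvertex-false (i<v , v<i+m) = cong₂ _∨_ (≤ᵇ-false i<v) (≤ᵇ-false v<i+m)

  embC-within-D⇒edge : ∀ {s t} → s < t →
    i ≤ embC i (suc M) s → embC i (suc M) t ≤ i + suc M → s ≡ i × t ≡ suc i
  embC-within-D⇒edge {s} {t} s<t i≤s′ t′≤ with embC-cases s | embC-cases t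
  ... | inj₂ (i<s , es) | _ = ⊥-elim (<⇒≱ (embC-strictMono s<t) (≤-trans t′≤ s′≥))
    where
    s′≥ : i + suc M ≤ embC i (suc M) s
    s′≥ rewrite es | +-suc i M = +-monoˡ-≤ M i<s
  ... | inj₁ (s≤i , es) | inj₁ (t≤i , _) rewrite es = ⊥-elim (<⇒≱ s<t (≤-trans t≤i i≤s′))
  ... | inj₁ (s≤i , es) | inj₂ (i<t , et) rewrite es | et =
    s≡i , ≤-antisym (+-cancelʳ-≤ M t (suc i) (subst (t + M ≤_) (+-suc i M) t′≤)) (subst (_< t) s≡i s<t)
    where
    s≡i : s ≡ i
    s≡i = ≤-antisym s≤i i≤s′

embC-embC : ∀ {i M K J} s → J ≤ M → embC (i + J) (suc K) (embC i (suc M) s) ≡ embC i (suc (M + K)) s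
embC-embC {i} {M} {K} {J} s J≤M with embC-cases {i} {M} s
... | inj₁ (s≤i , e) rewrite e = trans (embC-≤ (≤-trans s≤i (m≤m+n i J))) (sym (embC-≤ s≤i))
... | inj₂ (i<s , e) rewrite e =
  trans (embC-> (≤-<-trans (+-monoʳ-≤ i J≤M) (+-monoˡ-< M i<s))) (trans (+-assoc s M K) (sym (embC-> i<s)))

embC-comm : ∀ {i j M K} v → i < j →
            embC (j + M) (suc K) (embC i (suc M) v) ≡ embC i (suc M) (embC j (suc K) v)
embC-comm {i} {j} {M} {K} v i<j with embC-cases {i} {M} v | embC-cases {j} {K} v
... | inj₁ (v≤i , e) | _ rewrite e =
  trans (embC-≤ (≤-trans v≤i (≤-trans (<⇒≤ i<j) (m≤m+n j M))))
        (sym (trans (cong (embC i (suc M)) (embC-≤ (≤-trans v≤i (<⇒≤ i<j)))) (embC-≤ v≤i)))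
... | inj₂ (_ , e) | inj₁ (v≤j , f) rewrite f | e = embC-≤ (+-monoˡ-≤ M v≤j)
... | inj₂ (i<v , e) | inj₂ (j<v , f) rewrite e | f =
  trans (embC-> (+-monoˡ-< M j<v)) (trans (xy∙z≈xz∙y v M K) (sym (embC-> (<-≤-trans i<v (m≤m+n v K)))))

embC-shift : ∀ p {q K} v → embC (p + q) (suc K) (p + v) ≡ p + embC q (suc K) v
embC-shift p {q} {K} v with embC-cases {q} {K} v
... | inj₁ (v≤q , e) rewrite e = embC-≤ (+-monoʳ-≤ p v≤q)
... | inj₂ (q<v , e) rewrite e = trans (embC-> (+-monoʳ-< p q<v)) (+-assoc p v K)

module _ {n M i : ℕ} {c d : Col} where

  compose-glued : compose n (suc M) c i d i (i + suc M) ≡ glue (c i (suc i)) (d 1 (suc (suc M)))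
  compose-glued = trans (if-cong (cong₂ _∧_ (≤ᵇ-true (≤-refl {i})) (≤ᵇ-true (≤-refl {i + suc M}))))
                        (if-cong (cong₂ _∧_ (≡ᵇ-true {i} refl) (≡ᵇ-true {i + suc M} refl)))

  compose-fromD : ∀ {s t} → t ≤ suc M → ¬ (s ≡ 0 × t ≡ suc M) →
                  compose n (suc M) c i d (i + s) (i + t) ≡ d (suc s) (suc t)
  compose-fromD {s} {t} t≤ notBase =
    trans (if-cong (cong₂ _∧_ (≤ᵇ-true (m≤m+n i s)) (≤ᵇ-true (+-monoʳ-≤ i t≤))))
    (trans (if-cong (≡ᵇ-∧-false notGlued))
           (cong₂ (λ u v → d (suc u) (suc v)) (m+n∸m≡n i s) (m+n∸m≡n i t)))
    where
    notGlued : ¬ (i + s ≡ i × i + t ≡ i + suc M)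
    notGlued (e₁ , e₂) =
      notBase (+-cancelˡ-≡ i s 0 (trans e₁ (sym (+-identityʳ i))) , +-cancelˡ-≡ i t (suc M) e₂)

  compose-fromC : ∀ {s t} → s < t → ¬ (s ≡ i × t ≡ suc i) →
                  compose n (suc M) c i d (embC i (suc M) s) (embC i (suc M) t) ≡ c s t
  compose-fromC {s} {t} s<t notEdge =
    trans (if-cong (≤ᵇ-∧-false (λ (i≤s′ , t′≤) → notEdge (embC-within-D⇒edge s<t i≤s′ t′≤))))
    (trans (if-cong (cong₂ _∧_ (isCvertex-true (embC-CVertex s)) (isCvertex-true (embC-CVertex t))))
           (cong₂ c (preC-embC s) (preC-embC t)))

  compose-across : ∀ {a b} → ¬ (i ≤ a × b ≤ i + suc M) → Interior i M a ⊎ Interior i M b →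
                   compose n (suc M) c i d a b ≡ uncoloured
  compose-across {a} {b} notInD interior =
    trans (if-cong (≤ᵇ-∧-false notInD)) (if-cong (∧-false (map isCvertex-false isCvertex-false interior)))

-- C has size n and D has size suc M; arc (suc s, suc t) of D sits at (i + s, i + t).
data ArcOrigin (n M i a b : ℕ) : Set where
  glued  : a ≡ i → b ≡ i + suc M → ArcOrigin n M i a b
  fromD  : ∀ s t → s < t → t ≤ suc M → ¬ (s ≡ 0 × t ≡ suc M) →
           a ≡ i + s → b ≡ i + t → ArcOrigin n M i a b
  fromC  : ∀ s t → ValidArc n s t → ¬ (s ≡ i × t ≡ suc i) →
           a ≡ embC i (suc M) s → b ≡ embC i (suc M) t → ArcOrigin n M i a b
  across : ¬ (i ≤ a × b ≤ i + suc M) → Interior i M a ⊎ Interior i M b → ArcOrigin n M i a b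

originColour : ∀ {n M i a b} → Col → Col → ArcOrigin n M i a b → Colour
originColour {M = M} {i} c d (glued _ _)           = glue (c i (suc i)) (d 1 (suc (suc M)))
originColour             c d (fromD s t _ _ _ _ _) = d (suc s) (suc t)
originColour             c d (fromC s t _ _ _ _)   = c s t
originColour             c d (across _ _)          = uncoloured

compose-origin : ∀ {n M i a b c d} (o : ArcOrigin n M i a b) →
                 compose n (suc M) c i d a b ≡ originColour c d o
compose-origin {n} {M} {i} {c = c} {d} (glued refl refl) = compose-glued {n} {M} {i} {c} {d}
compose-origin {n} {M} {i} {c = c} {d} (fromD _ _ _ t≤ notBase refl refl) =
  compose-fromD {n} {M} {i} {c} {d} t≤ notBase
compose-origin {n} {M} {i} {c = c} {d} (fromC _ _ (_ , s<t , _) notEdge refl refl) =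
  compose-fromC {n} {M} {i} {c} {d} s<t notEdge
compose-origin {n} {M} {i} {c = c} {d} (across notInD interior) =
  compose-across {n} {M} {i} {c} {d} notInD interior

module _ {n M i : ℕ} (i≤n : i ≤ n) where

  originWithinD : ∀ {a b} → i ≤ a → b ≤ i + suc M → a < b → ArcOrigin n M i a b
  originWithinD {a} {b} i≤a b≤ a<b with (a ≟ i) ×-dec (b ≟ i + suc M)
  ... | yes (a≡i , b≡) = glued a≡i b≡
  ... | no  notGlued   =
    fromD (a ∸ i) (b ∸ i) (∸-monoˡ-< a<b i≤a) (subst (b ∸ i ≤_) (m+n∸m≡n i (suc M)) (∸-monoˡ-≤ i b≤))
          notBase (sym (m+[n∸m]≡n i≤a)) (sym (m+[n∸m]≡n i≤b))
    where
    i≤b : i ≤ b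
    i≤b = ≤-trans i≤a (<⇒≤ a<b)
    notBase : ¬ (a ∸ i ≡ 0 × b ∸ i ≡ suc M)
    notBase (e₁ , e₂) = notGlued (trans (sym (m+[n∸m]≡n i≤a)) (trans (cong (i +_) e₁) (+-identityʳ i)) ,
                                  trans (sym (m+[n∸m]≡n i≤b)) (cong (i +_) e₂))

  originFromC : ∀ {a b s t} → a ≡ embC i (suc M) s → b ≡ embC i (suc M) t →
                ¬ (i ≤ a × b ≤ i + suc M) → ValidArc (n + M) a b → ArcOrigin n M i a b
  originFromC {s = s} {t} refl refl notInD (1≤a , a<b , b≤) =
    fromC s t (embC-positive 1≤a , embC-cancel-< a<b , embC-bounded i≤n b≤) notEdge refl refl
    where
    notEdge : ¬ (s ≡ i × t ≡ suc i)
    notEdge (refl , refl) = notInD (≤-reflexive (sym (embC-≤ ≤-refl)) ,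
                                    ≤-reflexive (trans (embC-> (n<1+n i)) (sym (+-suc i M))))

  originOutsideD : ∀ {a b} → ¬ (i ≤ a × b ≤ i + suc M) → ValidArc (n + M) a b → ArcOrigin n M i a b
  originOutsideD {a} {b} notInD arc with cvertex? a | cvertex? b
  ... | inj₂ a-int | _          = across notInD (inj₁ a-int)
  ... | inj₁ _     | inj₂ b-int = across notInD (inj₂ b-int)
  ... | inj₁ a-C   | inj₁ b-C   = originFromC {s = preC i (suc M) a} {preC i (suc M) b}
                                   (sym (embC-preC a-C)) (sym (embC-preC b-C)) notInD arc

  origin : ∀ {a b} → ValidArc (n + M) a b → ArcOrigin n M i a b
  origin {a} {b} arc@(_ , a<b , _) with i ≤? a | b ≤? i + suc M
  ... | yes i≤a | yes b≤ = originWithinD i≤a b≤ a<b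
  ... | no  i≰a | _      = originOutsideD (λ (i≤a , _) → i≰a i≤a) arc
  ... | yes _   | no  b≰ = originOutsideD (λ (_ , b≤) → b≰ b≤) arc

blue≢uncoloured : ¬ blue ≡ uncoloured
blue≢uncoloured ()

+≡1 : ∀ {j u} → 1 ≤ j → j + u ≡ 1 → j ≡ 1 × u ≡ 0
+≡1 {suc zero}    {zero}  _ _  = refl , refl
+≡1 {suc zero}    {suc _} _ ()
+≡1 {suc (suc _)} {_}     _ ()

glue-red : ∀ x y → glue x y ≡ red → x ≡ uncoloured × y ≡ uncoloured
glue-red uncoloured uncoloured _  = refl , refl
glue-red blue       blue       ()
glue-red blue       red        ()
glue-red blue       uncoloured ()
glue-red red        blue       ()
glue-red red        red        ()
glue-red red        uncoloured ()
glue-red uncoloured blue       ()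
glue-red uncoloured red        ()

module _ {n : ℕ} {c : Col} (C : IsBNC n c) where

  edge-not-red : ∀ {i} → 1 ≤ i → i ≤ n → ¬ c i (suc i) ≡ red
  edge-not-red 1≤i i≤n isRed = proj₁ (IsBNC.red-diag C _ _ (1≤i , ≤-refl , s≤s i≤n) isRed) refl

  base-not-red : ¬ c 1 (suc n) ≡ red
  base-not-red isRed =
    proj₂ (IsBNC.red-diag C 1 (suc n) (≤-refl , s≤s (IsBNC.size-pos C) , ≤-refl) isRed) (refl , refl)

size-compose : ∀ n M → n + suc M ∸ 1 ≡ n + M
size-compose n M = cong (_∸ 1) (+-suc n M)

resize : ∀ {N N′ a b} → N ≡ N′ → ValidArc N a b → ValidArc N′ a b
resize refl arc = arc


module _ {n M i : ℕ} {c d : Col} (C : IsBNC n c) (D : IsBNC (suc M) d) (1≤i : 1 ≤ i) (i≤n : i ≤ n) where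

  private
    E : Col
    E = compose n (suc M) c i d

  origins-cross : ∀ {a b k l} (o : ArcOrigin n M i a b) (o′ : ArcOrigin n M i k l) →
                  a < k → k < b → b < l → l ≤ suc (n + M) →
                  Coloured (originColour c d o) → Coloured (originColour c d o′) → ⊥
  origins-cross (across _ _) _ _ _ _ _ () _
  origins-cross _ (across _ _) _ _ _ _ _ ()
  origins-cross (glued refl _) (glued refl _) a<k _ _ _ _ _ = <-irrefl refl a<k
  origins-cross (glued _ refl) (fromD _ _ _ t≤ _ _ refl) _ _ b<l _ _ _ = <⇒≱ b<l (+-monoʳ-≤ i t≤)
  origins-cross (glued refl refl) (fromC s _ _ _ refl _) a<k k<b _ _ _ _ =
    Interior-¬CVertex (a<k , k<b) (embC-CVertex s)
  origins-cross (fromD s _ _ _ _ refl _) (glued refl _) a<k _ _ _ _ _ = <⇒≱ a<k (m≤m+n i s)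
  origins-cross (fromD s t _ _ _ refl refl) (fromD s′ t′ _ t′≤ _ refl refl) a<k k<b b<l _ col col′ =
    IsBNC.noncrossing D (suc s) (suc t) (suc s′) (suc t′) (s≤s z≤n)
      (s≤s (+-cancelˡ-< i s s′ a<k)) (s≤s (+-cancelˡ-< i s′ t k<b)) (s≤s (+-cancelˡ-< i t t′ b<l))
      (s≤s t′≤)
      col col′
  origins-cross (fromD s t _ t≤ _ refl refl) (fromC s′ _ _ _ refl _) a<k k<b _ _ _ _ =
    Interior-¬CVertex (≤-<-trans (m≤m+n i s) a<k , <-≤-trans k<b (+-monoʳ-≤ i t≤)) (embC-CVertex s′)
  origins-cross (fromC _ t _ _ _ refl) (glued refl refl) _ k<b b<l _ _ _ =
    Interior-¬CVertex (k<b , b<l) (embC-CVertex t)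
  origins-cross (fromC _ t _ _ _ refl) (fromD s′ t′ _ t′≤ _ refl refl) _ k<b b<l _ _ _ =
    Interior-¬CVertex (≤-<-trans (m≤m+n i s′) k<b , <-≤-trans b<l (+-monoʳ-≤ i t′≤)) (embC-CVertex t)
  origins-cross (fromC s t (1≤s , _) _ refl refl) (fromC s′ t′ (_ , _ , t′≤) _ refl refl)
                a<k k<b b<l _ col col′ =
    IsBNC.noncrossing C s t s′ t′ 1≤s (embC-cancel-< a<k) (embC-cancel-< k<b) (embC-cancel-< b<l) t′≤
      col col′

  compose-noncrossing : ∀ a b k l → 1 ≤ a → a < k → k < b → b < l → l ≤ suc (n + M) →
                        Coloured (E a b) → Coloured (E k l) → ⊥
  compose-noncrossing a b k l 1≤a a<k k<b b<l l≤ col col′ =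
    origins-cross o o′ a<k k<b b<l l≤
      (subst Coloured (compose-origin {c = c} {d} o) col) (subst Coloured (compose-origin {c = c} {d} o′) col′)
    where
    o  : ArcOrigin n M i a b
    o  = origin i≤n (1≤a , <-trans a<k k<b , ≤-trans (<⇒≤ b<l) l≤)
    o′ : ArcOrigin n M i k l
    o′ = origin i≤n (≤-trans 1≤a (<⇒≤ a<k) , <-trans k<b b<l , l≤)

  origin-redDiag : ∀ {a b} (o : ArcOrigin n M i a b) → originColour c d o ≡ red → IsDiagonal (n + M) a b
  origin-redDiag (across _ _) ()
  -- Both glued arcs are uncoloured, so neither factor has size 1, whose only arc is blue.
  origin-redDiag (glued refl refl) isRed = notEdge , notBase
    where
    edge∘base-uncoloured : c i (suc i) ≡ uncoloured × d 1 (suc (suc M)) ≡ uncoloured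
    edge∘base-uncoloured = glue-red _ _ isRed
    notEdge : ¬ (i + suc M ≡ suc i)
    notEdge e = blue≢uncoloured (trans (sym (IsBNC.size-one D (cong suc M≡0)))
                  (subst (λ m → d 1 (suc (suc m)) ≡ uncoloured) M≡0 (proj₂ edge∘base-uncoloured)))
      where
      M≡0 : M ≡ 0
      M≡0 = suc-injective (+-cancelˡ-≡ i (suc M) 1 (trans e (+-comm 1 i)))
    notBase : ¬ (i ≡ 1 × i + suc M ≡ suc (n + M))
    notBase (i≡1 , e) = blue≢uncoloured (trans (sym (IsBNC.size-one C n≡1))
                          (subst (λ j → c j (suc j) ≡ uncoloured) i≡1 (proj₁ edge∘base-uncoloured)))
      where
      n≡1 : n ≡ 1
      n≡1 = sym (+-cancelʳ-≡ M 1 n (suc-injective (trans (cong (_+ suc M) (sym i≡1)) e)))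
  origin-redDiag (fromD s t s<t t≤ notBaseD refl refl) isRed = notEdge , notBase
    where
    notEdge : ¬ (i + t ≡ suc (i + s))
    notEdge e = proj₁ (IsBNC.red-diag D (suc s) (suc t) (s≤s z≤n , s≤s s<t , s≤s t≤) isRed)
                  (cong suc (+-cancelˡ-≡ i t (suc s) (trans e (sym (+-suc i s)))))
    notBase : ¬ (i + s ≡ 1 × i + t ≡ suc (n + M))
    notBase (e₁ , e₂) with +≡1 1≤i e₁
    ... | refl , refl =
      notBaseD (refl , ≤-antisym t≤ (subst (suc M ≤_) (sym t≡n+M) (+-monoˡ-≤ M (IsBNC.size-pos C))))
      where
      t≡n+M : t ≡ n + M
      t≡n+M = suc-injective e₂
  origin-redDiag (fromC s t valid@(_ , s<t , _) _ refl refl) isRed = notEdge , notBase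
    where
    diagonalInC : IsDiagonal n s t
    diagonalInC = IsBNC.red-diag C s t valid isRed
    notEdge : ¬ (embC i (suc M) t ≡ suc (embC i (suc M) s))
    notEdge e = proj₁ diagonalInC (embC-edge s<t refl e)
    notBase : ¬ (embC i (suc M) s ≡ 1 × embC i (suc M) t ≡ suc (n + M))
    notBase (e₁ , e₂) = proj₂ diagonalInC (embC-one 1≤i e₁ , embC-top i≤n e₂)

  compose-redDiag : ∀ a b → ValidArc (n + M) a b → E a b ≡ red → IsDiagonal (n + M) a b
  compose-redDiag a b arc isRed = origin-redDiag o (trans (sym (compose-origin {c = c} {d} o)) isRed)
    where o = origin i≤n arc

¬IsBNC-0 : ∀ {c} → ¬ IsBNC 0 c
¬IsBNC-0 C with IsBNC.size-pos C
... | ()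

compose-size-one : ∀ {n M i c d} → IsBNC n c → IsBNC (suc M) d → 1 ≤ i → i ≤ n → n + M ≡ 1 →
                   compose n (suc M) c i d 1 2 ≡ blue
compose-size-one {1} {0} {1} C D _ _ _ = cong₂ glue (IsBNC.size-one C refl) (IsBNC.size-one D refl)
compose-size-one {0} C = ⊥-elim (¬IsBNC-0 C)
compose-size-one {1} {0} {suc (suc _)} _ _ _ (s≤s ())

compose-isBNC : ∀ {n M i c d} → IsBNC n c → IsBNC (suc M) d → 1 ≤ i → i ≤ n →
                IsBNC (n + M) (compose n (suc M) c i d)
compose-isBNC {n} {M} C D 1≤i i≤n = record
  { size-pos    = ≤-trans (IsBNC.size-pos C) (m≤m+n n M)
  ; size-one    = compose-size-one C D 1≤i i≤n
  ; noncrossing = compose-noncrossing C D 1≤i i≤n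
  ; red-diag    = compose-redDiag C D 1≤i i≤n
  }

isBNC-compose : ∀ n m c d i → IsBNC n c → IsBNC m d → 1 ≤ i → i ≤ n →
                IsBNC (n + m ∸ 1) (compose n m c i d)
isBNC-compose n zero    c d i C D = ⊥-elim (¬IsBNC-0 D)
isBNC-compose n (suc M) c d i C D 1≤i i≤n =
  subst (λ N → IsBNC N (compose n (suc M) c i d)) (sym (size-compose n M)) (compose-isBNC C D 1≤i i≤n)

isBNC-unit : IsBNC 1 unitBNC
isBNC-unit = record
  { size-pos    = ≤-refl
  ; size-one    = λ _ → refl
  ; noncrossing = λ { _ _ _ _ (s≤s z≤n) (s≤s (s≤s z≤n)) (s≤s (s≤s (s≤s z≤n)))
                        (s≤s (s≤s (s≤s (s≤s z≤n)))) (s≤s (s≤s ())) }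
  ; red-diag    = λ _ _ _ ()
  }

originColour-cong : ∀ {n M i a b c c′ d d′} → 1 ≤ i → i ≤ n → c ≈[ n ] c′ → d ≈[ suc M ] d′ →
                    (o : ArcOrigin n M i a b) → originColour c d o ≡ originColour c′ d′ o
originColour-cong {M = M} {i} 1≤i i≤n c≈ d≈ (glued _ _) =
  cong₂ glue (c≈ i (suc i) (1≤i , ≤-refl , s≤s i≤n))
             (d≈ 1 (suc (suc M)) (≤-refl , s≤s (s≤s z≤n) , ≤-refl))
originColour-cong _ _ _ d≈ (fromD s t s<t t≤ _ _ _) = d≈ (suc s) (suc t) (s≤s z≤n , s≤s s<t , s≤s t≤)
originColour-cong _ _ c≈ _ (fromC s t valid _ _ _)  = c≈ s t valid
originColour-cong _ _ _ _ (across _ _)              = refl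

compose-cong-≈ : ∀ n m c c′ d d′ i → IsBNC n c → IsBNC m d → 1 ≤ i → i ≤ n →
                 c ≈[ n ] c′ → d ≈[ m ] d′ → compose n m c i d ≈[ n + m ∸ 1 ] compose n m c′ i d′
compose-cong-≈ n zero    c c′ d d′ i C D = ⊥-elim (¬IsBNC-0 D)
compose-cong-≈ n (suc M) c c′ d d′ i C D 1≤i i≤n c≈ d≈ a b arc = begin
  compose n (suc M) c i d a b    ≡⟨ compose-origin {c = c} {d} o ⟩
  originColour c d o             ≡⟨ originColour-cong 1≤i i≤n c≈ d≈ o ⟩
  originColour c′ d′ o           ≡⟨ compose-origin {c = c′} {d′} o ⟨
  compose n (suc M) c′ i d′ a b  ∎
  where
  open ≡-Reasoning
  o : ArcOrigin n M i a b
  o = origin i≤n (resize (size-compose n M) arc)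

glue-blueˡ : ∀ {y} → ¬ y ≡ red → glue blue y ≡ y
glue-blueˡ {blue}       _ = refl
glue-blueˡ {red}        y≢red = ⊥-elim (y≢red refl)
glue-blueˡ {uncoloured} _ = refl

glue-blueʳ : ∀ {x} → ¬ x ≡ red → glue x blue ≡ x
glue-blueʳ {blue}       _ = refl
glue-blueʳ {red}        x≢red = ⊥-elim (x≢red refl)
glue-blueʳ {uncoloured} _ = refl

arc-of-size-one : ∀ {s t} → ValidArc 1 s t → s ≡ 1 × t ≡ 2
arc-of-size-one (s≤s z≤n , s≤s (s≤s z≤n) , s≤s (s≤s z≤n)) = refl , refl

unit-left-≈ : ∀ n x → IsBNC n x → compose 1 n unitBNC 1 x ≈[ n ] x
unit-left-≈ zero    x X = ⊥-elim (¬IsBNC-0 X)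
unit-left-≈ (suc M) x X a b arc@(1≤a , _ , b≤) =
  trans (compose-origin {c = unitBNC} {x} o) (originColour-unitˡ o)
  where
  o : ArcOrigin 1 M 1 a b
  o = origin ≤-refl arc
  originColour-unitˡ : (o : ArcOrigin 1 M 1 a b) → originColour unitBNC x o ≡ x a b
  originColour-unitˡ (glued refl refl)              = glue-blueˡ (base-not-red X)
  originColour-unitˡ (fromD _ _ _ _ _ refl refl)    = refl
  originColour-unitˡ (fromC _ _ valid notEdge _ _)  = ⊥-elim (notEdge (arc-of-size-one valid))
  originColour-unitˡ (across notInD _)              = ⊥-elim (notInD (1≤a , b≤))

embC-identity : ∀ i v → embC i 1 v ≡ v
embC-identity i v with embC-cases {i} {0} v
... | inj₁ (_ , e) = e
... | inj₂ (_ , e) = trans e (+-identityʳ v)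

unit-right-≈ : ∀ n x i → IsBNC n x → 1 ≤ i → i ≤ n → compose n 1 x i unitBNC ≈[ n ] x
unit-right-≈ n x i X 1≤i i≤n a b arc =
  trans (compose-origin {c = x} {unitBNC} o) (originColour-unitʳ o)
  where
  o : ArcOrigin n 0 i a b
  o = origin i≤n (resize (sym (+-identityʳ n)) arc)
  originColour-unitʳ : (o : ArcOrigin n 0 i a b) → originColour x unitBNC o ≡ x a b
  originColour-unitʳ (glued refl refl) = trans (glue-blueʳ (edge-not-red X 1≤i i≤n)) (cong (x i) (+-comm 1 i))
  originColour-unitʳ (fromD _ _ (s≤s z≤n) (s≤s z≤n) notBase _ _) = ⊥-elim (notBase (refl , refl))
  originColour-unitʳ (fromC s t _ _ refl refl) = sym (cong₂ x (embC-identity i s) (embC-identity i t))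
  originColour-unitʳ (across _ interior) = ⊥-elim ([ no-interior , no-interior ] interior)
    where
    no-interior : ∀ {v} → ¬ Interior i 0 v
    no-interior {v} (i<v , v<i+1) = <⇒≱ i<v (≤-pred (subst (v <_) (+-comm i 1) v<i+1))

module Comparison (L R : Col) where

  Agree : ℕ → ℕ → Colour → Set
  Agree a b v = L a b ≡ v × R a b ≡ v

  agree-at : ∀ {a b a′ b′ v} → a ≡ a′ → b ≡ b′ → Agree a′ b′ v → L a b ≡ R a b
  agree-at refl refl (Lv , Rv) = trans Lv (sym Rv)

  ResolvedBy : Col → ℕ → ℕ → Set
  ResolvedBy E a b = E a b ≡ uncoloured ⊎ L a b ≡ R a b

  resolved⇒≡ : ∀ {a b} → ResolvedBy L a b → ResolvedBy R a b → L a b ≡ R a b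
  resolved⇒≡ (inj₂ L≡R)   _            = L≡R
  resolved⇒≡ (inj₁ _)     (inj₂ L≡R)   = L≡R
  resolved⇒≡ (inj₁ L-unc) (inj₁ R-unc) = trans L-unc (sym R-unc)

module Sequential {n M K J i : ℕ} {x y z : Col} (X : IsBNC n x) (Y : IsBNC (suc M) y) (Z : IsBNC (suc K) z)
                  (1≤i : 1 ≤ i) (i≤n : i ≤ n) (J≤M : J ≤ M) where

  A B L R : Col
  A = compose n (suc M) x i y
  B = compose (suc M) (suc K) y (suc J) z
  L = compose (n + M) (suc K) A (i + J) z
  R = compose n (suc (M + K)) x i B

  open Comparison L R

  open ≡-Reasoning

  agree-x : ∀ {s t} → s < t → ¬ (s ≡ i × t ≡ suc i) →
            Agree (embC i (suc (M + K)) s) (embC i (suc (M + K)) t) (x s t)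
  agree-x {s} {t} s<t notEdge = L-value , compose-fromC {n} {M + K} {i} {x} {B} s<t notEdge
    where
    notEdgeA : ¬ (embC i (suc M) s ≡ i + J × embC i (suc M) t ≡ suc (i + J))
    notEdgeA (e₁ , e₂) = notEdge (s≡i , trans (embC-edge s<t e₁ e₂) (cong suc s≡i))
      where
      s≡i : s ≡ i
      s≡i = embC≡i+⇒≡i J≤M e₁
    L-value : L (embC i (suc (M + K)) s) (embC i (suc (M + K)) t) ≡ x s t
    L-value = begin
      L (embC i (suc (M + K)) s) (embC i (suc (M + K)) t)
        ≡⟨ cong₂ L (embC-embC s J≤M) (embC-embC t J≤M) ⟨
      L (embC (i + J) (suc K) (embC i (suc M) s)) (embC (i + J) (suc K) (embC i (suc M) t))
        ≡⟨ compose-fromC {n + M} {K} {i + J} {A} {z} (embC-strictMono s<t) notEdgeA ⟩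
      A (embC i (suc M) s) (embC i (suc M) t)
        ≡⟨ compose-fromC {n} {M} {i} {x} {y} s<t notEdge ⟩
      x s t ∎

  agree-z : ∀ {u w} → w ≤ suc K → ¬ (u ≡ 0 × w ≡ suc K) →
            Agree (i + J + u) (i + J + w) (z (suc u) (suc w))
  agree-z {u} {w} w≤ notBase = compose-fromD {n + M} {K} {i + J} {A} {z} w≤ notBase , R-value
    where
    w′≤ : J + w ≤ suc (M + K)
    w′≤ = subst (J + w ≤_) (+-suc M K) (+-mono-≤ J≤M w≤)
    notBaseB : ¬ (J + u ≡ 0 × J + w ≡ suc (M + K))
    notBaseB (e₁ , e₂) =
      notBase (m+n≡0⇒n≡0 J e₁ , ≤-antisym w≤ (subst (suc K ≤_) (sym w≡) (s≤s (m≤n+m K M))))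
      where
      w≡ : w ≡ suc (M + K)
      w≡ = trans (cong (_+ w) (sym (m+n≡0⇒m≡0 J e₁))) e₂
    R-value : R (i + J + u) (i + J + w) ≡ z (suc u) (suc w)
    R-value = begin
      R (i + J + u) (i + J + w)       ≡⟨ cong₂ R (+-assoc i J u) (+-assoc i J w) ⟩
      R (i + (J + u)) (i + (J + w))   ≡⟨ compose-fromD {n} {M + K} {i} {x} {B} w′≤ notBaseB ⟩
      B (suc J + u) (suc J + w)       ≡⟨ compose-fromD {suc M} {K} {suc J} {y} {z} w≤ notBase ⟩
      z (suc u) (suc w)               ∎

  agree-y : ∀ {u w} → u < w → w ≤ suc M → ¬ (u ≡ 0 × w ≡ suc M) → ¬ (u ≡ J × w ≡ suc J) →
            Agree (i + embC J (suc K) u) (i + embC J (suc K) w) (y (suc u) (suc w))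
  agree-y {u} {w} u<w w≤ notBase notEdge = L-value , R-value
    where
    notEdgeA : ¬ (i + u ≡ i + J × i + w ≡ suc (i + J))
    notEdgeA (e₁ , e₂) =
      notEdge (+-cancelˡ-≡ i u J e₁ , +-cancelˡ-≡ i w (suc J) (trans e₂ (sym (+-suc i J))))
    L-value : L (i + embC J (suc K) u) (i + embC J (suc K) w) ≡ y (suc u) (suc w)
    L-value = begin
      L (i + embC J (suc K) u) (i + embC J (suc K) w)
        ≡⟨ cong₂ L (embC-shift i {J} {K} u) (embC-shift i {J} {K} w) ⟨
      L (embC (i + J) (suc K) (i + u)) (embC (i + J) (suc K) (i + w))
        ≡⟨ compose-fromC {n + M} {K} {i + J} {A} {z} (+-monoʳ-< i u<w) notEdgeA ⟩
      A (i + u) (i + w)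
        ≡⟨ compose-fromD {n} {M} {i} {x} {y} w≤ notBase ⟩
      y (suc u) (suc w) ∎
    t≤ : embC J (suc K) w ≤ suc (M + K)
    t≤ = ≤-trans (embC-mono w≤) (≤-reflexive (embC-> {J} {K} (s≤s J≤M)))
    notBaseB : ¬ (embC J (suc K) u ≡ 0 × embC J (suc K) w ≡ suc (M + K))
    notBaseB (e₁ , e₂) = notBase (n≤0⇒n≡0 (subst (u ≤_) e₁ (embC-≥ u)) , embC-top J≤M e₂)
    notEdgeB : ¬ (suc u ≡ suc J × suc w ≡ suc (suc J))
    notEdgeB (e₁ , e₂) = notEdge (suc-injective e₁ , suc-injective e₂)
    R-value : R (i + embC J (suc K) u) (i + embC J (suc K) w) ≡ y (suc u) (suc w)
    R-value = begin
      R (i + embC J (suc K) u) (i + embC J (suc K) w)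
        ≡⟨ compose-fromD {n} {M + K} {i} {x} {B} t≤ notBaseB ⟩
      B (suc (embC J (suc K) u)) (suc (embC J (suc K) w))
        ≡⟨ cong₂ B (embC-shift 1 {J} {K} u) (embC-shift 1 {J} {K} w) ⟨
      B (embC (suc J) (suc K) (suc u)) (embC (suc J) (suc K) (suc w))
        ≡⟨ compose-fromC {suc M} {K} {suc J} {y} {z} (s≤s u<w) notEdgeB ⟩
      y (suc u) (suc w) ∎

  agree-xy : ¬ (J ≡ 0 × M ≡ 0) → Agree i (i + suc (M + K)) (glue (x i (suc i)) (y 1 (suc (suc M))))
  agree-xy notUnit = L-value , R-value
    where
    notEdgeA : ¬ (i ≡ i + J × i + suc M ≡ suc (i + J))
    notEdgeA (e₁ , e₂) = notUnit (J≡0 , trans M≡J J≡0)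
      where
      J≡0 : J ≡ 0
      J≡0 = +-cancelˡ-≡ i J 0 (trans (sym e₁) (sym (+-identityʳ i)))
      M≡J : M ≡ J
      M≡J = +-cancelˡ-≡ i M J (suc-injective (trans (sym (+-suc i M)) e₂))
    notEdgeB : ¬ (1 ≡ suc J × suc (suc M) ≡ suc (suc J))
    notEdgeB (e₁ , e₂) = notUnit (J≡0 , trans (suc-injective (suc-injective e₂)) J≡0)
      where
      J≡0 : J ≡ 0
      J≡0 = sym (suc-injective e₁)
    L-value : L i (i + suc (M + K)) ≡ glue (x i (suc i)) (y 1 (suc (suc M)))
    L-value = begin
      L i (i + suc (M + K))
        ≡⟨ cong₂ L (embC-≤ (m≤m+n i J)) (trans (embC-> (+-monoʳ-< i (s≤s J≤M))) (+-assoc i (suc M) K)) ⟨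
      L (embC (i + J) (suc K) i) (embC (i + J) (suc K) (i + suc M))
        ≡⟨ compose-fromC {n + M} {K} {i + J} {A} {z} (m<m+n i z<s) notEdgeA ⟩
      A i (i + suc M)
        ≡⟨ compose-glued {n} {M} {i} {x} {y} ⟩
      glue (x i (suc i)) (y 1 (suc (suc M))) ∎
    B-base : B 1 (suc (suc (M + K))) ≡ y 1 (suc (suc M))
    B-base = begin
      B 1 (suc (suc (M + K)))
        ≡⟨ cong₂ B (embC-≤ {suc J} {K} (s≤s z≤n)) (embC-> {suc J} {K} (s≤s (s≤s J≤M))) ⟨
      B (embC (suc J) (suc K) 1) (embC (suc J) (suc K) (suc (suc M)))
        ≡⟨ compose-fromC {suc M} {K} {suc J} {y} {z} (s≤s (s≤s z≤n)) notEdgeB ⟩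
      y 1 (suc (suc M)) ∎
    R-value : R i (i + suc (M + K)) ≡ glue (x i (suc i)) (y 1 (suc (suc M)))
    R-value = trans (compose-glued {n} {M + K} {i} {x} {B}) (cong (glue (x i (suc i))) B-base)

  agree-yz : ¬ (J ≡ 0 × M ≡ 0) →
             Agree (i + J) (i + J + suc K) (glue (y (suc J) (suc (suc J))) (z 1 (suc (suc K))))
  agree-yz notUnit = L-value , R-value
    where
    zb : Colour
    zb = z 1 (suc (suc K))
    notBaseY : ¬ (J ≡ 0 × suc J ≡ suc M)
    notBaseY (J≡0 , e) = notUnit (J≡0 , trans (sym (suc-injective e)) J≡0)
    t≤ : J + suc K ≤ suc (M + K)
    t≤ = subst (J + suc K ≤_) (+-suc M K) (+-monoˡ-≤ (suc K) J≤M)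
    notBaseB : ¬ (J ≡ 0 × J + suc K ≡ suc (M + K))
    notBaseB (J≡0 , e) =
      notUnit (J≡0 , +-cancelʳ-≡ K M 0 (suc-injective (trans (sym e) (cong (_+ suc K) J≡0))))
    L-value : L (i + J) (i + J + suc K) ≡ glue (y (suc J) (suc (suc J))) zb
    L-value = begin
      L (i + J) (i + J + suc K)            ≡⟨ compose-glued {n + M} {K} {i + J} {A} {z} ⟩
      glue (A (i + J) (suc (i + J))) zb    ≡⟨ cong (λ v → glue (A (i + J) v) zb) (+-suc i J) ⟨
      glue (A (i + J) (i + suc J)) zb
        ≡⟨ cong (λ v → glue v zb) (compose-fromD {n} {M} {i} {x} {y} (s≤s J≤M) notBaseY) ⟩
      glue (y (suc J) (suc (suc J))) zb    ∎
    R-value : R (i + J) (i + J + suc K) ≡ glue (y (suc J) (suc (suc J))) zb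
    R-value = begin
      R (i + J) (i + J + suc K)            ≡⟨ cong (R (i + J)) (+-assoc i J (suc K)) ⟩
      R (i + J) (i + (J + suc K))          ≡⟨ compose-fromD {n} {M + K} {i} {x} {B} t≤ notBaseB ⟩
      B (suc J) (suc J + suc K)            ≡⟨ compose-glued {suc M} {K} {suc J} {y} {z} ⟩
      glue (y (suc J) (suc (suc J))) zb    ∎

  i+0≡i : J ≡ 0 → i + J ≡ i
  i+0≡i J≡0 = trans (cong (i +_) J≡0) (+-identityʳ i)

  -- y has size 1, and gluing its blue arc to a non-red arc keeps that arc's colour.
  agree-xyz : J ≡ 0 → M ≡ 0 → Agree (i + J) (i + J + suc K) (glue (x i (suc i)) (z 1 (suc (suc K))))
  agree-xyz J≡0 M≡0 = L-value , R-value
    where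
    xe zb : Colour
    xe = x i (suc i)
    zb = z 1 (suc (suc K))
    i+J≡i : i + J ≡ i
    i+J≡i = i+0≡i J≡0
    y-blue : ∀ {a b} → a ≡ 1 → b ≡ 2 → y a b ≡ blue
    y-blue refl refl = IsBNC.size-one Y (cong suc M≡0)
    L-value : L (i + J) (i + J + suc K) ≡ glue xe zb
    L-value = begin
      L (i + J) (i + J + suc K)
        ≡⟨ compose-glued {n + M} {K} {i + J} {A} {z} ⟩
      glue (A (i + J) (suc (i + J))) zb
        ≡⟨ cong (λ v → glue v zb)
                (cong₂ A i+J≡i (trans (sym (+-suc i J)) (cong (λ m → i + suc m) (trans J≡0 (sym M≡0))))) ⟩
      glue (A i (i + suc M)) zb
        ≡⟨ cong (λ v → glue v zb) (compose-glued {n} {M} {i} {x} {y}) ⟩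
      glue (glue xe (y 1 (suc (suc M)))) zb
        ≡⟨ cong (λ v → glue (glue xe v) zb) (y-blue refl (cong (λ m → suc (suc m)) M≡0)) ⟩
      glue (glue xe blue) zb
        ≡⟨ cong (λ v → glue v zb) (glue-blueʳ (edge-not-red X 1≤i i≤n)) ⟩
      glue xe zb ∎
    R-value : R (i + J) (i + J + suc K) ≡ glue xe zb
    R-value = begin
      R (i + J) (i + J + suc K)
        ≡⟨ cong₂ R i+J≡i (trans (cong (_+ suc K) i+J≡i) (cong (λ m → i + suc (m + K)) (sym M≡0))) ⟩
      R i (i + suc (M + K))
        ≡⟨ compose-glued {n} {M + K} {i} {x} {B} ⟩
      glue xe (B 1 (suc (suc (M + K))))
        ≡⟨ cong (glue xe) (cong₂ B (cong suc (sym J≡0))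
                                   (trans (cong (λ m → suc (suc (m + K))) M≡0)
                                          (cong (λ j → suc j + suc K) (sym J≡0)))) ⟩
      glue xe (B (suc J) (suc J + suc K))
        ≡⟨ cong (glue xe) (compose-glued {suc M} {K} {suc J} {y} {z}) ⟩
      glue xe (glue (y (suc J) (suc (suc J))) zb)
        ≡⟨ cong (λ v → glue xe (glue v zb)) (y-blue (cong suc J≡0) (cong (λ j → suc (suc j)) J≡0)) ⟩
      glue xe (glue blue zb)
        ≡⟨ cong (glue xe) (glue-blueˡ (base-not-red Z)) ⟩
      glue xe zb ∎

  resolve-within-B : ∀ {s t} → s < t → t ≤ suc (M + K) → ¬ (s ≡ 0 × t ≡ suc (M + K)) →
                     ResolvedBy R (i + s) (i + t)
  resolve-within-B {s} {t} s<t t≤ notBase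
    with origin {suc M} {K} {suc J} (s≤s J≤M) (s≤s z≤n , s≤s s<t , s≤s t≤)
  ... | across notInD interior =
    inj₁ (trans (compose-fromD {n} {M + K} {i} {x} {B} t≤ notBase)
                (compose-across {suc M} {K} {suc J} {y} {z} notInD interior))
  ... | fromD u w _ w≤ notBaseZ e₁ e₂ =
    inj₂ (agree-at (z-position e₁) (z-position e₂) (agree-z w≤ notBaseZ))
    where
    z-position : ∀ {s u} → suc s ≡ suc J + u → i + s ≡ i + J + u
    z-position {u = u} e = trans (cong (i +_) (suc-injective e)) (sym (+-assoc i J u))
  ... | glued e₁ e₂ with (J ≟ 0) ×-dec (M ≟ 0)
  ...   | yes (J≡0 , M≡0) =
    ⊥-elim (notBase (trans (suc-injective e₁) J≡0 ,
                     trans (suc-injective e₂) (cong₂ (λ j m → j + suc (m + K)) J≡0 (sym M≡0))))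
  ...   | no notUnit =
    inj₂ (agree-at (cong (i +_) (suc-injective e₁))
                   (trans (cong (i +_) (suc-injective e₂)) (sym (+-assoc i J (suc K))))
                   (agree-yz notUnit))
  resolve-within-B {s} {t} s<t t≤ notBase
    | fromC (suc u) (suc w) (_ , s≤s u<w , s≤s w≤) notEdgeB e₁ e₂ =
    inj₂ (agree-at (cong (i +_) s≡) (cong (i +_) t≡) (agree-y u<w w≤ notBaseY notEdgeY))
    where
    s≡ : s ≡ embC J (suc K) u
    s≡ = suc-injective (trans e₁ (embC-shift 1 {J} {K} u))
    t≡ : t ≡ embC J (suc K) w
    t≡ = suc-injective (trans e₂ (embC-shift 1 {J} {K} w))
    notBaseY : ¬ (u ≡ 0 × w ≡ suc M)
    notBaseY (u≡0 , w≡) = notBase (trans s≡ (cong (embC J (suc K)) u≡0) ,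
                                   trans t≡ (trans (cong (embC J (suc K)) w≡) (embC-> {J} {K} (s≤s J≤M))))
    notEdgeY : ¬ (u ≡ J × w ≡ suc J)
    notEdgeY (e₁ , e₂) = notEdgeB (cong suc e₁ , cong suc e₂)

  resolve-via-R : ∀ {a b} → ValidArc (n + (M + K)) a b → ResolvedBy R a b
  resolve-via-R arc with origin {n} {M + K} {i} i≤n arc
  ... | across notInD interior = inj₁ (compose-across {n} {M + K} {i} {x} {B} notInD interior)
  ... | fromC _ _ (_ , s<t , _) notEdge refl refl = inj₂ (agree-at refl refl (agree-x s<t notEdge))
  ... | fromD _ _ s<t t≤ notBase refl refl = resolve-within-B s<t t≤ notBase
  ... | glued refl refl with (J ≟ 0) ×-dec (M ≟ 0)
  ...   | no notUnit = inj₂ (agree-at refl refl (agree-xy notUnit))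
  ...   | yes (J≡0 , M≡0) =
    inj₂ (agree-at (sym (i+0≡i J≡0))
                   (trans (cong (λ m → i + suc (m + K)) M≡0) (cong (_+ suc K) (sym (i+0≡i J≡0))))
                   (agree-xyz J≡0 M≡0))

  resolve-within-A : ∀ {s t} → ValidArc (n + M) s t → ¬ (s ≡ i + J × t ≡ suc (i + J)) →
                     ResolvedBy L (embC (i + J) (suc K) s) (embC (i + J) (suc K) t)
  resolve-within-A validA@(_ , s<t , _) notEdgeA with origin {n} {M} {i} i≤n validA
  ... | across notInD interior =
    inj₁ (trans (compose-fromC {n + M} {K} {i + J} {A} {z} s<t notEdgeA)
                (compose-across {n} {M} {i} {x} {y} notInD interior))
  ... | fromC u w (_ , u<w , _) notEdgeX refl refl =
    inj₂ (agree-at (embC-embC u J≤M) (embC-embC w J≤M) (agree-x u<w notEdgeX))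
  ... | fromD u w u<w w≤ notBaseY refl refl =
    inj₂ (agree-at (embC-shift i {J} {K} u) (embC-shift i {J} {K} w) (agree-y u<w w≤ notBaseY notEdgeY))
    where
    notEdgeY : ¬ (u ≡ J × w ≡ suc J)
    notEdgeY (e₁ , e₂) = notEdgeA (cong (i +_) e₁ , trans (cong (i +_) e₂) (+-suc i J))
  ... | glued refl refl with (J ≟ 0) ×-dec (M ≟ 0)
  ...   | yes (J≡0 , M≡0) =
    ⊥-elim (notEdgeA (sym (i+0≡i J≡0) ,
                      trans (+-suc i M) (cong (λ m → suc (i + m)) (trans M≡0 (sym J≡0)))))
  ...   | no notUnit =
    inj₂ (agree-at (embC-≤ (m≤m+n i J)) (trans (embC-> (+-monoʳ-< i (s≤s J≤M))) (+-assoc i (suc M) K))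
                   (agree-xy notUnit))

  resolve-via-L : ∀ {a b} → ValidArc (n + M + K) a b → ResolvedBy L a b
  resolve-via-L arc with origin {n + M} {K} {i + J} (+-mono-≤ i≤n J≤M) arc
  ... | across notInD interior = inj₁ (compose-across {n + M} {K} {i + J} {A} {z} notInD interior)
  ... | fromD _ _ _ w≤ notBase refl refl = inj₂ (agree-at refl refl (agree-z w≤ notBase))
  ... | fromC _ _ validA notEdgeA refl refl = resolve-within-A validA notEdgeA
  ... | glued refl refl with (J ≟ 0) ×-dec (M ≟ 0)
  ...   | yes (J≡0 , M≡0) = inj₂ (agree-at refl refl (agree-xyz J≡0 M≡0))
  ...   | no notUnit      = inj₂ (agree-at refl refl (agree-yz notUnit))

  assoc : ∀ a b → ValidArc (n + (M + K)) a b → L a b ≡ R a b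
  assoc a b arc = resolved⇒≡ (resolve-via-L (resize (sym (+-assoc n M K)) arc)) (resolve-via-R arc)

module Parallel {n M K i j : ℕ} {x y z : Col} (i<j : i < j) (j≤n : j ≤ n) where

  A C L R : Col
  A = compose n (suc M) x i y
  C = compose n (suc K) x j z
  L = compose (n + M) (suc K) A (j + M) z
  R = compose (n + K) (suc M) C i y

  open Comparison L R

  open ≡-Reasoning

  i+1+M≤j+M : i + suc M ≤ j + M
  i+1+M≤j+M = subst (_≤ j + M) (sym (+-suc i M)) (+-monoˡ-≤ M i<j)

  embC-below-y : ∀ {v} → v ≤ i + suc M → embC (j + M) (suc K) v ≡ v
  embC-below-y v≤ = embC-≤ (≤-trans v≤ i+1+M≤j+M)

  embC-z : ∀ u → embC i (suc M) (j + u) ≡ j + M + u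
  embC-z u = trans (embC-> (<-≤-trans i<j (m≤m+n j u))) (xy∙z≈xz∙y j u M)

  agree-x : ∀ {u w} → u < w → ¬ (u ≡ i × w ≡ suc i) → ¬ (u ≡ j × w ≡ suc j) →
            Agree (embC i (suc M) (embC j (suc K) u)) (embC i (suc M) (embC j (suc K) w)) (x u w)
  agree-x {u} {w} u<w notEdgeᵢ notEdgeⱼ = L-value , R-value
    where
    notEdgeA : ¬ (embC i (suc M) u ≡ j + M × embC i (suc M) w ≡ suc (j + M))
    notEdgeA (e₁ , e₂) = notEdgeⱼ (u≡j , trans (embC-edge u<w e₁ e₂) (cong suc u≡j))
      where
      u≡j : u ≡ j
      u≡j with embC-cases {i} {M} u
      ... | inj₁ (u≤i , e) =
        ⊥-elim (<⇒≱ (<-≤-trans i<j (m≤m+n j M)) (subst (_≤ i) (trans (sym e) e₁) u≤i))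
      ... | inj₂ (_ , e)   = +-cancelʳ-≡ M u j (trans (sym e) e₁)
    notEdgeC : ¬ (embC j (suc K) u ≡ i × embC j (suc K) w ≡ suc i)
    notEdgeC (e₁ , e₂) = notEdgeᵢ (u≡i , trans (embC-edge u<w e₁ e₂) (cong suc u≡i))
      where
      u≡i : u ≡ i
      u≡i with embC-cases {j} {K} u
      ... | inj₁ (_ , e)   = trans (sym e) e₁
      ... | inj₂ (j<u , e) =
        ⊥-elim (<⇒≱ (<-trans i<j (<-≤-trans j<u (m≤m+n u K))) (≤-reflexive (trans (sym e) e₁)))
    L-value : L (embC i (suc M) (embC j (suc K) u)) (embC i (suc M) (embC j (suc K) w)) ≡ x u w
    L-value = begin
      L (embC i (suc M) (embC j (suc K) u)) (embC i (suc M) (embC j (suc K) w))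
        ≡⟨ cong₂ L (embC-comm u i<j) (embC-comm w i<j) ⟨
      L (embC (j + M) (suc K) (embC i (suc M) u)) (embC (j + M) (suc K) (embC i (suc M) w))
        ≡⟨ compose-fromC {n + M} {K} {j + M} {A} {z} (embC-strictMono u<w) notEdgeA ⟩
      A (embC i (suc M) u) (embC i (suc M) w)
        ≡⟨ compose-fromC {n} {M} {i} {x} {y} u<w notEdgeᵢ ⟩
      x u w ∎
    R-value : R (embC i (suc M) (embC j (suc K) u)) (embC i (suc M) (embC j (suc K) w)) ≡ x u w
    R-value = begin
      R (embC i (suc M) (embC j (suc K) u)) (embC i (suc M) (embC j (suc K) w))
        ≡⟨ compose-fromC {n + K} {M} {i} {C} {y} (embC-strictMono u<w) notEdgeC ⟩
      C (embC j (suc K) u) (embC j (suc K) w)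
        ≡⟨ compose-fromC {n} {K} {j} {x} {z} u<w notEdgeⱼ ⟩
      x u w ∎

  agree-y : ∀ {u w} → u < w → w ≤ suc M → ¬ (u ≡ 0 × w ≡ suc M) →
            Agree (i + u) (i + w) (y (suc u) (suc w))
  agree-y {u} {w} u<w w≤ notBase = L-value , compose-fromD {n + K} {M} {i} {C} {y} w≤ notBase
    where
    i+w≤ : i + w ≤ i + suc M
    i+w≤ = +-monoʳ-≤ i w≤
    notEdgeA : ¬ (i + u ≡ j + M × i + w ≡ suc (j + M))
    notEdgeA (_ , e₂) = 1+n≰n (subst (_≤ j + M) e₂ (≤-trans i+w≤ i+1+M≤j+M))
    L-value : L (i + u) (i + w) ≡ y (suc u) (suc w)
    L-value = begin
      L (i + u) (i + w)
        ≡⟨ cong₂ L (embC-below-y (≤-trans (<⇒≤ (+-monoʳ-< i u<w)) i+w≤)) (embC-below-y i+w≤) ⟨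
      L (embC (j + M) (suc K) (i + u)) (embC (j + M) (suc K) (i + w))
        ≡⟨ compose-fromC {n + M} {K} {j + M} {A} {z} (+-monoʳ-< i u<w) notEdgeA ⟩
      A (i + u) (i + w)
        ≡⟨ compose-fromD {n} {M} {i} {x} {y} w≤ notBase ⟩
      y (suc u) (suc w) ∎

  agree-z : ∀ {u w} → u < w → w ≤ suc K → ¬ (u ≡ 0 × w ≡ suc K) →
            Agree (j + M + u) (j + M + w) (z (suc u) (suc w))
  agree-z {u} {w} u<w w≤ notBase = compose-fromD {n + M} {K} {j + M} {A} {z} w≤ notBase , R-value
    where
    notEdgeC : ¬ (j + u ≡ i × j + w ≡ suc i)
    notEdgeC (e₁ , _) = <⇒≱ i<j (subst (j ≤_) e₁ (m≤m+n j u))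
    R-value : R (j + M + u) (j + M + w) ≡ z (suc u) (suc w)
    R-value = begin
      R (j + M + u) (j + M + w)
        ≡⟨ cong₂ R (embC-z u) (embC-z w) ⟨
      R (embC i (suc M) (j + u)) (embC i (suc M) (j + w))
        ≡⟨ compose-fromC {n + K} {M} {i} {C} {y} (+-monoʳ-< j u<w) notEdgeC ⟩
      C (j + u) (j + w)
        ≡⟨ compose-fromD {n} {K} {j} {x} {z} w≤ notBase ⟩
      z (suc u) (suc w) ∎

  agree-xy : Agree i (i + suc M) (glue (x i (suc i)) (y 1 (suc (suc M))))
  agree-xy = L-value , R-value
    where
    i<i+1+M : i < i + suc M
    i<i+1+M = m<m+n i z<s
    notEdgeA : ¬ (i ≡ j + M × i + suc M ≡ suc (j + M))
    notEdgeA (e₁ , _) = <⇒≱ (<-≤-trans i<j (m≤m+n j M)) (≤-reflexive (sym e₁))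
    notEdgeC : ¬ (i ≡ j × suc i ≡ suc j)
    notEdgeC (e₁ , _) = <-irrefl e₁ i<j
    L-value : L i (i + suc M) ≡ glue (x i (suc i)) (y 1 (suc (suc M)))
    L-value = begin
      L i (i + suc M)
        ≡⟨ cong₂ L (embC-below-y (<⇒≤ i<i+1+M)) (embC-below-y ≤-refl) ⟨
      L (embC (j + M) (suc K) i) (embC (j + M) (suc K) (i + suc M))
        ≡⟨ compose-fromC {n + M} {K} {j + M} {A} {z} i<i+1+M notEdgeA ⟩
      A i (i + suc M)
        ≡⟨ compose-glued {n} {M} {i} {x} {y} ⟩
      glue (x i (suc i)) (y 1 (suc (suc M))) ∎
    C-edge : C i (suc i) ≡ x i (suc i)
    C-edge = begin
      C i (suc i)                                 ≡⟨ cong₂ C (embC-≤ (<⇒≤ i<j)) (embC-≤ i<j) ⟨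
      C (embC j (suc K) i) (embC j (suc K) (suc i)) ≡⟨ compose-fromC {n} {K} {j} {x} {z} ≤-refl notEdgeC ⟩
      x i (suc i)                                 ∎
    R-value : R i (i + suc M) ≡ glue (x i (suc i)) (y 1 (suc (suc M)))
    R-value = trans (compose-glued {n + K} {M} {i} {C} {y}) (cong (λ v → glue v (y 1 (suc (suc M)))) C-edge)

  agree-xz : Agree (j + M) (j + M + suc K) (glue (x j (suc j)) (z 1 (suc (suc K))))
  agree-xz = L-value , R-value
    where
    notEdgeA : ¬ (j ≡ i × suc j ≡ suc i)
    notEdgeA (e₁ , _) = <-irrefl (sym e₁) i<j
    notEdgeC : ¬ (j ≡ i × j + suc K ≡ suc i)
    notEdgeC (e₁ , _) = <-irrefl (sym e₁) i<j
    A-edge : A (j + M) (suc (j + M)) ≡ x j (suc j)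
    A-edge = begin
      A (j + M) (suc (j + M))                       ≡⟨ cong₂ A (embC-> i<j) (embC-> (<-trans i<j (n<1+n j))) ⟨
      A (embC i (suc M) j) (embC i (suc M) (suc j)) ≡⟨ compose-fromC {n} {M} {i} {x} {y} ≤-refl notEdgeA ⟩
      x j (suc j)                                   ∎
    L-value : L (j + M) (j + M + suc K) ≡ glue (x j (suc j)) (z 1 (suc (suc K)))
    L-value = trans (compose-glued {n + M} {K} {j + M} {A} {z}) (cong (λ v → glue v (z 1 (suc (suc K)))) A-edge)
    R-value : R (j + M) (j + M + suc K) ≡ glue (x j (suc j)) (z 1 (suc (suc K)))
    R-value = begin
      R (j + M) (j + M + suc K)
        ≡⟨ cong₂ R (embC-> i<j) (embC-z (suc K)) ⟨
      R (embC i (suc M) j) (embC i (suc M) (j + suc K))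
        ≡⟨ compose-fromC {n + K} {M} {i} {C} {y} (m<m+n j z<s) notEdgeC ⟩
      C j (j + suc K)
        ≡⟨ compose-glued {n} {K} {j} {x} {z} ⟩
      glue (x j (suc j)) (z 1 (suc (suc K))) ∎

  resolve-via-L : ∀ {a b} → ValidArc (n + M + K) a b → ResolvedBy L a b
  resolve-via-L arc with origin {n + M} {K} {j + M} (+-monoˡ-≤ M j≤n) arc
  ... | across notInD interior = inj₁ (compose-across {n + M} {K} {j + M} {A} {z} notInD interior)
  ... | glued refl refl = inj₂ (agree-at refl refl agree-xz)
  ... | fromD _ _ u<w w≤ notBase refl refl = inj₂ (agree-at refl refl (agree-z u<w w≤ notBase))
  ... | fromC s t validA@(_ , s<t , _) notEdgeA refl refl with origin {n} {M} {i} (≤-trans (<⇒≤ i<j) j≤n) validA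
  ...   | across notInD interior =
    inj₁ (trans (compose-fromC {n + M} {K} {j + M} {A} {z} s<t notEdgeA)
                (compose-across {n} {M} {i} {x} {y} notInD interior))
  ...   | glued refl refl = inj₂ (agree-at (embC-below-y (<⇒≤ (m<m+n i z<s))) (embC-below-y ≤-refl) agree-xy)
  ...   | fromD _ _ u<w w≤ notBase refl refl =
    inj₂ (agree-at (embC-below-y (+-monoʳ-≤ i (≤-trans (<⇒≤ u<w) w≤)))
                   (embC-below-y (+-monoʳ-≤ i w≤))
                   (agree-y u<w w≤ notBase))
  ...   | fromC u w (_ , u<w , _) notEdgeᵢ refl refl =
    inj₂ (agree-at (embC-comm u i<j) (embC-comm w i<j) (agree-x u<w notEdgeᵢ notEdgeⱼ))
    where
    notEdgeⱼ : ¬ (u ≡ j × w ≡ suc j)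
    notEdgeⱼ (refl , refl) = notEdgeA (embC-> i<j , embC-> (<-trans i<j (n<1+n j)))

  resolve-via-R : ∀ {a b} → ValidArc (n + K + M) a b → ResolvedBy R a b
  resolve-via-R arc with origin {n + K} {M} {i} (≤-trans (<⇒≤ i<j) (≤-trans j≤n (m≤m+n n K))) arc
  ... | across notInD interior = inj₁ (compose-across {n + K} {M} {i} {C} {y} notInD interior)
  ... | glued refl refl = inj₂ (agree-at refl refl agree-xy)
  ... | fromD _ _ u<w w≤ notBase refl refl = inj₂ (agree-at refl refl (agree-y u<w w≤ notBase))
  ... | fromC s t validC@(_ , s<t , _) notEdgeC refl refl with origin {n} {K} {j} j≤n validC
  ...   | across notInD interior =
    inj₁ (trans (compose-fromC {n + K} {M} {i} {C} {y} s<t notEdgeC)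
                (compose-across {n} {K} {j} {x} {z} notInD interior))
  ...   | glued refl refl = inj₂ (agree-at (embC-> i<j) (embC-z (suc K)) agree-xz)
  ...   | fromD u w u<w w≤ notBase refl refl = inj₂ (agree-at (embC-z u) (embC-z w) (agree-z u<w w≤ notBase))
  ...   | fromC u w (_ , u<w , _) notEdgeⱼ refl refl = inj₂ (agree-at refl refl (agree-x u<w notEdgeᵢ notEdgeⱼ))
    where
    notEdgeᵢ : ¬ (u ≡ i × w ≡ suc i)
    notEdgeᵢ (refl , refl) = notEdgeC (embC-≤ (<⇒≤ i<j) , embC-≤ i<j)

  assoc : ∀ a b → ValidArc (n + (M + K)) a b → L a b ≡ R a b
  assoc a b arc = resolved⇒≡ (resolve-via-L (resize (sym (+-assoc n M K)) arc))
                             (resolve-via-R (resize n+M+K≡n+K+M arc))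
    where
    n+M+K≡n+K+M : n + (M + K) ≡ n + K + M
    n+M+K≡n+K+M = trans (cong (n +_) (+-comm M K)) (sym (+-assoc n K M))

size-compose₃ : ∀ n M K → n + suc M + suc K ∸ 2 ≡ n + (M + K)
size-compose₃ n M K = cong (_∸ 2) (begin
  n + suc M + suc K         ≡⟨ +-suc (n + suc M) K ⟩
  suc (n + suc M + K)       ≡⟨ cong (λ m → suc (m + K)) (+-suc n M) ⟩
  suc (suc (n + M + K))     ≡⟨ cong (λ m → suc (suc m)) (+-assoc n M K) ⟩
  suc (suc (n + (M + K)))   ∎)
  where open ≡-Reasoning

assoc-seq-≈ : ∀ n m k x y z i j → IsBNC n x → IsBNC m y → IsBNC k z →
              1 ≤ i → i ≤ n → 1 ≤ j → j ≤ m →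
              compose (n + m ∸ 1) k (compose n m x i y) (i + j ∸ 1) z
                ≈[ n + m + k ∸ 2 ]
              compose n (m + k ∸ 1) x i (compose m k y j z)
assoc-seq-≈ n zero    k       x y z i j X Y Z = ⊥-elim (¬IsBNC-0 Y)
assoc-seq-≈ n (suc M) zero    x y z i j X Y Z = ⊥-elim (¬IsBNC-0 Z)
-- compose ignores its first argument, so only the position i + j ∸ 1 and the size of
-- y ∘ⱼ z need rewriting.
assoc-seq-≈ n (suc M) (suc K) x y z i (suc J) X Y Z 1≤i i≤n _ (s≤s J≤M) a b arc
  rewrite size-compose i J | +-suc M K =
  Sequential.assoc {x = x} {y} {z} X Y Z 1≤i i≤n J≤M a b (resize (size-compose₃ n M K) arc)

assoc-par-≈ : ∀ n m k x y z i j → IsBNC n x → IsBNC m y → IsBNC k z →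
              1 ≤ i → i < j → j ≤ n →
              compose (n + m ∸ 1) k (compose n m x i y) (j + m ∸ 1) z
                ≈[ n + m + k ∸ 2 ]
              compose (n + k ∸ 1) m (compose n k x j z) i y
assoc-par-≈ n zero    k       x y z i j X Y Z = ⊥-elim (¬IsBNC-0 Y)
assoc-par-≈ n (suc M) zero    x y z i j X Y Z = ⊥-elim (¬IsBNC-0 Z)
assoc-par-≈ n (suc M) (suc K) x y z i j X Y Z _ i<j j≤n a b arc rewrite size-compose j M =
  Parallel.assoc {x = x} {y} {z} i<j j≤n a b (resize (size-compose₃ n M K) arc)

mainTheorem4 : CNCB-IsOperad
mainTheorem4 = record
  { compose-closed = isBNC-compose
  ; unit-closed    = isBNC-unit
  ; compose-cong   = compose-cong-≈
  ; assoc-seq      = assoc-seq-≈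
  ; assoc-par      = assoc-par-≈
  ; unit-left      = unit-left-≈
  ; unit-right     = unit-right-≈
  }
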